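{- Let $k\ge 1$ be an integer and let $a,b$ be integers such that $\gcd(a-b,12k)=1$, and such that either $2a-3b\equiv 6k \pmod{12k}$ or $3a-2b\equiv 6k \pmod{12k}$. Then the circulant digraph $\mathrm{Cay}(\mathbb{Z}_{12k}; 6k, a, b)$ has no hamiltonian circuit.
   Context: For a natural number $n$, $\mathbb{Z}_n$ denotes the additive cyclic group of integers modulo $n$. For a set $A$ of integers, $\mathrm{Cay}(\mathbb{Z}_n; A)$ is the digraph with vertex set $\mathbb{Z}_n$ having an arc from $u$ to $u+c \pmod n$ for every $u\in\mathbb{Z}_n$ and every $c\in A$; we write $\mathrm{Cay}(\mathbb{Z}_n; c_1,c_2,c_3)$ for $\mathrm{Cay}(\mathbb{Z}_n;\{c_1,c_2,c_3\})$. A hamiltonian circuit is a directed cycle passing through every vertex exactly once. -}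

module Defs where

open import Data.Nat as ℕ using (ℕ; zero; suc)
open import Data.Nat.DivMod using (_mod_)
open import Data.Integer as ℤ using (ℤ; +_; _-_)
open import Data.Integer.Divisibility using (_∣_)
open import Data.Fin using (Fin; toℕ)
open import Data.List using (List)
open import Data.List.Membership.Propositional using (_∈_)
open import Data.Product using (Σ; ∃; _×_)
open import Function.Definitions using (Injective)
open import Relation.Binary.PropositionalEquality using (_≡_)

_≡_[mod_] : ℤ → ℤ → ℕ → Set
x ≡ y [mod n ] = (+ n) ∣ (x - y)

-- Arc u → v in Cay(ℤ_n; A): v ≡ u + c (mod n) for some c ∈ A.
-- Vertices of ℤ_n are represented by Fin n (residues 0..n-1).
Arc : (n : ℕ) → List ℤ → Fin n → Fin n → Set
Arc n A u v = ∃ λ c → c ∈ A × ((+ toℕ v) ≡ (+ toℕ u) ℤ.+ c [mod n ])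

cycSucc : {n : ℕ} → Fin n → Fin n
cycSucc {suc m} i = suc (toℕ i) mod (suc m)

-- A hamiltonian circuit of Cay(ℤ_n; A): an enumeration v₀,…,v_{n-1} of all
-- vertices, each exactly once (injective on Fin n, hence bijective), with
-- an arc v_i → v_{i+1} for each i, indices taken mod n (closing arc included).
HamCircuit : (n : ℕ) → List ℤ → Set
HamCircuit n A =
  Σ (Fin n → Fin n) λ v → Injective _≡_ _≡_ v × (∀ i → Arc n A (v i) (v (cycSucc i)))

-- Multiplying by the inverse of d = a - b (a unit, hence odd) maps the circulant onto
-- Cay(ℤ_n; s, s + 2, s + 3) with n = 12k and s = 6k. There the successor map of a hamiltonian
-- circuit is next x = σ x + s, where σ x = x + j x with j x ∈ {0, 2, 3}, and σ is a permutation.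
-- Injectivity of σ forbids a few local patterns of j, which leaves three cases.
-- (1) j is 3 everywhere: next is translation by s + 3, whose order divides 4k < n.
-- (2) Every moving vertex is followed by a fixed one: then fixed vertices recur with step 2,
--     hence at distance s, and two fixed vertices at distance s form a 2-cycle of next.
-- (3) Otherwise every fixed vertex is preceded by two jumps of 3, and σ = h ∘ h for a
--     permutation h; then next = (translation by 3k)² ∘ h² is an even permutation, whereas an
--     n-cycle with n even is odd.

module Submission where

open import Defs
open import Algebra.Bundles using (CommutativeRing)
open import Data.Bool using (Bool; true; false; not; _∧_; _xor_)
open import Data.Bool.Properties
  using (∧-zeroʳ; not-injective; true-xor; xor-∧-commutativeRing; xor-comm; xor-same; xor-identityʳ)
open import Data.Empty using (⊥; ⊥-elim)
open import Data.Fin as Fin using (Fin; toℕ; zero; suc; fromℕ; punchOut)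
import Data.Fin.Properties as Finₚ
open import Data.Fin.Permutation as Perm using (Permutation; permutation; _⟨$⟩ˡ_)
open import Data.Integer as ℤ using (ℤ; +_; -_; _+_; _-_; ∣_∣; 0ℤ; 1ℤ)
import Data.Integer.Properties as ℤₚ
open import Data.Integer.DivMod
  using (_%ℕ_; _/ℕ_; n%ℕd<d; a≡a%ℕn+[a/ℕn]*n; n%d<d; a≡a%n+[a/n]*n)
  renaming (_%_ to _%ℤ_; _/_ to _/ℤ_)
open import Data.Integer.Divisibility.Signed
  using (divides; ∣ᵤ⇒∣; ∣⇒∣ᵤ; ∣m∣n⇒∣m+n; ∣n⇒∣m*n) renaming (_∣_ to _∣ₛ_)
open import Data.Integer.GCD using (gcd)
open import Data.Integer.Tactic.RingSolver using (solve-∀)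
open import Data.List as List using (List; _∷_; [])
open import Data.List.Membership.Propositional using (_∈_)
open import Data.List.Membership.Propositional.Properties using (∈-map⁻)
open import Data.List.Relation.Unary.Any using (here; there)
open import Data.Nat as ℕ using (ℕ; zero; suc; _<ᵇ_; z<s; s<s; s≤s)
import Data.Nat.Coprimality as ℕC
open import Data.Nat.Divisibility using (n∣m⇒m%n≡0) renaming (_∣_ to _ℕ∣_; ∣⇒≤ to ℕ∣⇒≤)
open import Data.Nat.DivMod using (_%_; n%n≡0; m<n⇒m%n≡m)
open import Data.Nat.GCD as ℕGCD using (module Bézout)
open import Data.Nat.GeneralisedArithmetic using (iterate)
import Data.Nat.Properties as ℕₚ
open import Data.Nat.Tactic.RingSolver using () renaming (solve-∀ to ℕ-solve-∀)
open import Data.Product using (∃; _×_; _,_; proj₁; proj₂)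
open import Data.Sum using (_⊎_; inj₁; inj₂)
open import Function using (_∘_; case_of_)
open import Function.Definitions using (Injective; StrictlySurjective)
open import Level using (0ℓ)
open import Relation.Binary using (Reflexive; Symmetric; Transitive; Setoid)
open import Relation.Binary.Definitions using (DecidableEquality)
open import Relation.Binary.PropositionalEquality
import Relation.Binary.Reasoning.Setoid as SetoidReasoning
open import Relation.Nullary using (¬_; ¬?; Dec; yes; no; _×-dec_)

injective⇒strictlySurjective : ∀ {n} {f : Fin n → Fin n} →
  Injective _≡_ _≡_ f → StrictlySurjective _≡_ f
injective⇒strictlySurjective {suc n} {f} f-inj y with Finₚ.any? (λ x → f x Fin.≟ y)
... | yes hit = hit
... | no miss = ⊥-elim (ℕₚ.1+n≰n (Finₚ.injective⇒≤ missing-inj))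
  where
    y≢f : ∀ x → ¬ y ≡ f x
    y≢f x y≡fx = miss (x , sym y≡fx)
    missing-inj : Injective _≡_ _≡_ (λ x → punchOut (y≢f x))
    missing-inj eq = f-inj (Finₚ.punchOut-injective (y≢f _) (y≢f _) eq)

injective⇒permutation : ∀ {n} {f : Fin n → Fin n} → Injective _≡_ _≡_ f → Permutation n n
injective⇒permutation {f = f} f-inj = permutation f
  (proj₁ ∘ injective⇒strictlySurjective f-inj)
  (proj₂ ∘ injective⇒strictlySurjective f-inj)
  (f-inj ∘ proj₂ ∘ injective⇒strictlySurjective f-inj ∘ f)

open CommutativeRing xor-∧-commutativeRing using (semiring)
open import Algebra.Properties.Semiring.Sum semiring
  using (sum-syntax; sum-cong-≗; ∑-distrib-+; ∑-comm; ∑-permute; *-distribˡ-sum)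
import Algebra.Properties.Semiring.Mult semiring as Xor

<ᵇ-true : ∀ {m n} → m ℕ.< n → (m <ᵇ n) ≡ true
<ᵇ-true {zero} z<s = refl
<ᵇ-true {suc m} (s<s m<n) = <ᵇ-true m<n

<ᵇ-false : ∀ {m n} → n ℕ.≤ m → (m <ᵇ n) ≡ false
<ᵇ-false {n = zero} _ = refl
<ᵇ-false {suc m} {suc n} (s≤s n≤m) = <ᵇ-false n≤m

<ᵇ-irrefl : ∀ m → (m <ᵇ m) ≡ false
<ᵇ-irrefl m = <ᵇ-false {m} ℕₚ.≤-refl

<ᵇ-flip : ∀ {m n} → m ≢ n → (n <ᵇ m) ≡ not (m <ᵇ n)
<ᵇ-flip {zero} {zero} m≢n = ⊥-elim (m≢n refl)
<ᵇ-flip {zero} {suc n} _ = refl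
<ᵇ-flip {suc m} {zero} _ = refl
<ᵇ-flip {suc m} {suc n} m≢n = <ᵇ-flip (m≢n ∘ cong suc)

inversion : ∀ {n} → (Fin n → Fin n) → Fin n → Fin n → Bool
inversion p a b = (toℕ a <ᵇ toℕ b) ∧ (toℕ (p b) <ᵇ toℕ (p a))

parity : ∀ {n} → (Fin n → Fin n) → Bool
parity {n} p = ∑[ a < n ] ∑[ b < n ] inversion p a b

parity-cong : ∀ {n} {p q : Fin n → Fin n} → (∀ x → p x ≡ q x) → parity p ≡ parity q
parity-cong p≗q = sum-cong-≗ λ a → sum-cong-≗ λ b →
  cong₂ (λ u w → _ ∧ (toℕ u <ᵇ toℕ w)) (p≗q b) (p≗q a)

∑∑-symmetric : ∀ {n} (T : Fin n → Fin n → Bool) →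
  (∀ a → T a a ≡ false) → (∀ a b → T a b ≡ T b a) →
  ∑[ a < n ] ∑[ b < n ] T a b ≡ false
∑∑-symmetric {zero} T diag sym-T = refl
∑∑-symmetric {suc n} T diag sym-T = begin
    (T zero zero xor row) xor ∑[ a < n ] (T (suc a) zero xor ∑[ b < n ] T (suc a) (suc b))
  ≡⟨ cong₂ (λ x y → (x xor row) xor y) (diag zero)
       (∑-distrib-+ (λ a → T (suc a) zero) (λ a → ∑[ b < n ] T (suc a) (suc b))) ⟩
    row xor (∑[ a < n ] T (suc a) zero xor ∑[ a < n ] ∑[ b < n ] T (suc a) (suc b))
  ≡⟨ cong₂ (λ x y → row xor (x xor y))
       (sum-cong-≗ (λ a → sym-T (suc a) zero))
       (∑∑-symmetric (λ a b → T (suc a) (suc b)) (diag ∘ suc) (λ a b → sym-T (suc a) (suc b))) ⟩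
    row xor (row xor false)
  ≡⟨ cong (row xor_) (xor-identityʳ row) ⟩
    row xor row
  ≡⟨ xor-same row ⟩
    false ∎
  where
    open ≡-Reasoning
    row = ∑[ b < n ] T zero (suc b)

private
  flip-inversions : ∀ u v w →
    (u ∧ not w) xor ((u ∧ not v) xor (v ∧ not w)) ≡
    (not u ∧ w) xor ((not u ∧ v) xor (not v ∧ w))
  flip-inversions true true true = refl
  flip-inversions true true false = refl
  flip-inversions true false true = refl
  flip-inversions true false false = refl
  flip-inversions false true true = refl
  flip-inversions false true false = refl
  flip-inversions false false true = refl
  flip-inversions false false false = refl

  xor≡false⇒≡ : ∀ x y → x xor y ≡ false → x ≡ y
  xor≡false⇒≡ false false _ = refl
  xor≡false⇒≡ true true _ = refl

  xor-cancelˡ : ∀ z {x y} → z xor x ≡ z xor y → x ≡ y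
  xor-cancelˡ false eq = eq
  xor-cancelˡ true eq = not-injective eq

module _ {n} {p q : Fin n → Fin n} (p-inj : Injective _≡_ _≡_ p) (q-inj : Injective _≡_ _≡_ q) where

  -- T is symmetric with zero diagonal, so its double sum vanishes; and that double sum is
  -- parity (p ∘ q) + parity q + parity p.
  private
    T : Fin n → Fin n → Bool
    T a b = inversion (p ∘ q) a b xor (inversion q a b xor inversion p (q a) (q b))

    T-diag : ∀ a → T a a ≡ false
    T-diag a rewrite <ᵇ-irrefl (toℕ a) | <ᵇ-irrefl (toℕ (q a)) = refl

    T-sym : ∀ a b → T a b ≡ T b a
    T-sym a b with a Fin.≟ b
    ... | yes refl = refl
    ... | no a≢b
      rewrite <ᵇ-flip {toℕ a} {toℕ b} (a≢b ∘ Finₚ.toℕ-injective)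
            | <ᵇ-flip {toℕ (q a)} {toℕ (q b)} (a≢b ∘ q-inj ∘ Finₚ.toℕ-injective)
            | <ᵇ-flip {toℕ (p (q a))} {toℕ (p (q b))} (a≢b ∘ q-inj ∘ p-inj ∘ Finₚ.toℕ-injective)
      = flip-inversions (toℕ a <ᵇ toℕ b) (toℕ (q a) <ᵇ toℕ (q b)) (toℕ (p (q a)) <ᵇ toℕ (p (q b)))

    parity-p-reindexed : parity p ≡ ∑[ a < n ] ∑[ b < n ] inversion p (q a) (q b)
    parity-p-reindexed = trans
      (sum-cong-≗ λ a → ∑-permute (inversion p a) π)
      (∑-permute (λ a → ∑[ b < n ] inversion p a (q b)) π)
      where π = injective⇒permutation q-inj

    defect-vanishes : parity (p ∘ q) xor (parity q xor parity p) ≡ false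
    defect-vanishes = begin
        parity (p ∘ q) xor (parity q xor parity p)
      ≡⟨ cong (λ x → parity (p ∘ q) xor (parity q xor x)) parity-p-reindexed ⟩
        parity (p ∘ q) xor (parity q xor ∑[ a < n ] ∑[ b < n ] inversion p (q a) (q b))
      ≡⟨ cong (parity (p ∘ q) xor_) (sym (∑-distrib-+ (λ a → ∑[ b < n ] inversion q a b) _)) ⟩
        parity (p ∘ q) xor ∑[ a < n ] (∑[ b < n ] inversion q a b xor ∑[ b < n ] inversion p (q a) (q b))
      ≡⟨ sym (∑-distrib-+ (λ a → ∑[ b < n ] inversion (p ∘ q) a b) _) ⟩
        ∑[ a < n ] (∑[ b < n ] inversion (p ∘ q) a b xor
                    (∑[ b < n ] inversion q a b xor ∑[ b < n ] inversion p (q a) (q b)))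
      ≡⟨ sum-cong-≗ (λ a → trans
           (cong (∑[ b < n ] inversion (p ∘ q) a b xor_)
             (sym (∑-distrib-+ (inversion q a) (λ b → inversion p (q a) (q b)))))
           (sym (∑-distrib-+ (inversion (p ∘ q) a) _))) ⟩
        ∑[ a < n ] ∑[ b < n ] T a b
      ≡⟨ ∑∑-symmetric T T-diag T-sym ⟩
        false ∎
      where open ≡-Reasoning

  parity-∘ : parity (p ∘ q) ≡ parity p xor parity q
  parity-∘ = trans (xor≡false⇒≡ _ _ defect-vanishes) (xor-comm (parity q) (parity p))

parity-square : ∀ {n} {p : Fin n → Fin n} → Injective _≡_ _≡_ p → parity (p ∘ p) ≡ false
parity-square {p = p} p-inj = trans (parity-∘ p-inj p-inj) (xor-same (parity p))

module _ {m : ℕ} where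

  private
    ρ : Fin (suc m) → Fin (suc m)
    ρ = cycSucc

    toℕ-ρ-last : ∀ {x} → toℕ x ≡ m → toℕ (ρ x) ≡ 0
    toℕ-ρ-last {x} x≡m =
      trans (Finₚ.toℕ-fromℕ< _) (trans (cong (λ i → suc i % suc m) x≡m) (n%n≡0 (suc m)))

    toℕ-ρ-< : ∀ {x} → toℕ x ℕ.< m → toℕ (ρ x) ≡ suc (toℕ x)
    toℕ-ρ-< x<m = trans (Finₚ.toℕ-fromℕ< _) (m<n⇒m%n≡m (s<s x<m))

  inversion-cycSucc : ∀ a b → inversion ρ a b ≡ not (toℕ b <ᵇ m) ∧ (toℕ a <ᵇ toℕ b)
  inversion-cycSucc a b with toℕ a ℕ.<? toℕ b | ℕₚ.m≤n⇒m<n∨m≡n (ℕₚ.≤-pred (Finₚ.toℕ<n b))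
  ... | no a≮b | _ rewrite <ᵇ-false (ℕₚ.≮⇒≥ a≮b) = sym (∧-zeroʳ _)
  ... | yes a<b | inj₁ b<m
    rewrite <ᵇ-true a<b | <ᵇ-true b<m | toℕ-ρ-< b<m | toℕ-ρ-< (ℕₚ.<-trans a<b b<m)
          | <ᵇ-false (ℕₚ.<⇒≤ a<b) = refl
  ... | yes a<b | inj₂ b≡m
    rewrite <ᵇ-true a<b | toℕ-ρ-last b≡m | toℕ-ρ-< (subst (toℕ a ℕ.<_) b≡m a<b)
          | b≡m | <ᵇ-irrefl m = refl

  private
    ∑-at-last : ∀ {k} (G : Fin (suc k) → Bool) →
      ∑[ b < suc k ] (not (toℕ b <ᵇ k) ∧ G b) ≡ G (fromℕ k)
    ∑-at-last {zero} G = xor-identityʳ (G zero)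
    ∑-at-last {suc k} G = ∑-at-last (G ∘ suc)

    ∑-below : ∀ k → ∑[ a < suc k ] (toℕ a <ᵇ k) ≡ k Xor.× true
    ∑-below zero = refl
    ∑-below (suc k) = cong (true xor_) (∑-below k)

  parity-cycSucc : parity ρ ≡ m Xor.× true
  parity-cycSucc = begin
      ∑[ a < suc m ] ∑[ b < suc m ] inversion ρ a b
    ≡⟨ sum-cong-≗ {suc m} (λ a → sum-cong-≗ {suc m} (inversion-cycSucc a)) ⟩
      ∑[ a < suc m ] ∑[ b < suc m ] (not (toℕ b <ᵇ m) ∧ (toℕ a <ᵇ toℕ b))
    ≡⟨ ∑-comm {suc m} {suc m} (λ a b → not (toℕ b <ᵇ m) ∧ (toℕ a <ᵇ toℕ b)) ⟩
      ∑[ b < suc m ] ∑[ a < suc m ] (not (toℕ b <ᵇ m) ∧ (toℕ a <ᵇ toℕ b))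
    ≡⟨ sum-cong-≗ {suc m} (λ b →
         sym (*-distribˡ-sum {suc m} (not (toℕ b <ᵇ m)) (λ a → toℕ a <ᵇ toℕ b))) ⟩
      ∑[ b < suc m ] (not (toℕ b <ᵇ m) ∧ ∑[ a < suc m ] (toℕ a <ᵇ toℕ b))
    ≡⟨ ∑-at-last {m} (λ b → ∑[ a < suc m ] (toℕ a <ᵇ toℕ b)) ⟩
      ∑[ a < suc m ] (toℕ a <ᵇ toℕ (fromℕ m))
    ≡⟨ cong (λ k → ∑[ a < suc m ] (toℕ a <ᵇ k)) (Finₚ.toℕ-fromℕ m) ⟩
      ∑[ a < suc m ] (toℕ a <ᵇ m)
    ≡⟨ ∑-below m ⟩
      m Xor.× true ∎
    where open ≡-Reasoning

cycSucc-odd : ∀ {n} .{{_ : ℕ.NonZero n}} s → n ≡ s ℕ.+ s → parity (cycSucc {n}) ≡ true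
cycSucc-odd {zero} ⦃ () ⦄
cycSucc-odd {suc m} s n≡s+s = trans (parity-cycSucc {m}) (not-injective (begin
    not (m Xor.× true)       ≡⟨ true-xor (m Xor.× true) ⟨
    suc m Xor.× true         ≡⟨ cong (Xor._× true) n≡s+s ⟩
    (s ℕ.+ s) Xor.× true     ≡⟨ Xor.×-homo-+ true s s ⟩
    s Xor.× true xor s Xor.× true ≡⟨ xor-same (s Xor.× true) ⟩
    false                ∎))
  where open ≡-Reasoning

module Modular (n : ℕ) .{{_ : ℕ.NonZero n}} where

  open import Data.Integer using (_*_)

  -- Wrapped in a record so that x and y can be inferred from a proof of x ≈ y.
  infix 4 _≈_
  record _≈_ (x y : ℤ) : Set where
    constructor mk≈
    field ≈⇒≡[mod] : x ≡ y [mod n ]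
  open _≈_ public

  private
    signed : ∀ {x y} → x ≈ y → + n ∣ₛ x - y
    signed = ∣ᵤ⇒∣ ∘ ≈⇒≡[mod]

    ≈-from : ∀ {x y} z → + n ∣ₛ z → z ≡ x - y → x ≈ y
    ≈-from z n∣z z≡x-y = mk≈ (∣⇒∣ᵤ (subst (+ n ∣ₛ_) z≡x-y n∣z))

  ≈-by : ∀ {x y} q → x - y ≡ q * + n → x ≈ y
  ≈-by q eq = mk≈ (∣⇒∣ᵤ (divides q eq))

  ≈-refl : Reflexive _≈_
  ≈-refl {x} = ≈-by 0ℤ (ℤₚ.+-inverseʳ x)

  ≈-sym : Symmetric _≈_
  ≈-sym {x} {y} (mk≈ n∣x-y) = mk≈ (subst (n ℕ∣_) (ℤₚ.∣i-j∣≡∣j-i∣ x y) n∣x-y)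

  ≈-trans : Transitive _≈_
  ≈-trans {x} {y} {z} x≈y y≈z = ≈-from _ (∣m∣n⇒∣m+n (signed x≈y) (signed y≈z)) (telescope x y z)
    where telescope : ∀ x y z → (x - y) + (y - z) ≡ x - z
          telescope = solve-∀

  ≈-reflexive : ∀ {x y} → x ≡ y → x ≈ y
  ≈-reflexive refl = ≈-refl

  ≈-setoid : Setoid 0ℓ 0ℓ
  ≈-setoid = record
    { Carrier = ℤ ; _≈_ = _≈_
    ; isEquivalence = record { refl = ≈-refl ; sym = ≈-sym ; trans = ≈-trans } }

  module ≈-Reasoning = SetoidReasoning ≈-setoid

  +-cong : ∀ {x y u w} → x ≈ y → u ≈ w → x + u ≈ y + w
  +-cong {x} {y} {u} {w} x≈y u≈w = ≈-from _ (∣m∣n⇒∣m+n (signed x≈y) (signed u≈w)) (regroup x y u w)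
    where regroup : ∀ x y u w → (x - y) + (u - w) ≡ (x + u) - (y + w)
          regroup = solve-∀

  *-congˡ : ∀ c {x y} → x ≈ y → c * x ≈ c * y
  *-congˡ c {x} {y} x≈y = ≈-from _ (∣n⇒∣m*n c (signed x≈y)) (distrib c x y)
    where distrib : ∀ c x y → c * (x - y) ≡ c * x - c * y
          distrib = solve-∀

  +-cancelʳ : ∀ c {x y} → x + c ≈ y + c → x ≈ y
  +-cancelʳ c {x} {y} x+c≈y+c = begin
      x               ≡⟨ add-sub x c ⟨
      (x + c) - c     ≈⟨ +-cong x+c≈y+c (≈-refl { - c}) ⟩
      (y + c) - c     ≡⟨ add-sub y c ⟩
      y               ∎
    where open ≈-Reasoning
          add-sub : ∀ x c → (x + c) - c ≡ x
          add-sub = solve-∀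

  *-congʳ : ∀ c {x y} → x ≈ y → x * c ≈ y * c
  *-congʳ c {x} {y} x≈y = begin
      x * c     ≡⟨ ℤₚ.*-comm x c ⟩
      c * x     ≈⟨ *-congˡ c x≈y ⟩
      c * y     ≡⟨ ℤₚ.*-comm c y ⟩
      y * c     ∎
    where open ≈-Reasoning

  multiple≈0 : ∀ q → q * + n ≈ 0ℤ
  multiple≈0 q = ≈-by q (ℤₚ.+-identityʳ (q * + n))

  ≈-linear : ∀ {x y u w} c q → x ≈ y → u - w ≡ c * (x - y) + q * + n → u ≈ w
  ≈-linear {x} {y} {u} {w} c q x≈y u-w≡ with signed x≈y
  ... | divides p x-y≡pn = ≈-by (c * p + q) (begin
      u - w                      ≡⟨ u-w≡ ⟩
      c * (x - y) + q * + n      ≡⟨ cong (λ z → c * z + q * + n) x-y≡pn ⟩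
      c * (p * + n) + q * + n    ≡⟨ factor c p q (+ n) ⟩
      (c * p + q) * + n          ∎)
    where open ≡-Reasoning
          factor : ∀ c p q n → c * (p * n) + q * n ≡ (c * p + q) * n
          factor = solve-∀

  *-cancelˡ : ∀ {e d x y} → e * d ≈ 1ℤ → e * x ≈ e * y → x ≈ y
  *-cancelˡ {e} {d} {x} {y} ed≈1 ex≈ey = begin
      x               ≡⟨ ℤₚ.*-identityˡ x ⟨
      1ℤ * x          ≈⟨ *-congʳ x ed≈1 ⟨
      e * d * x       ≡⟨ swap e d x ⟩
      d * (e * x)     ≈⟨ *-congˡ d ex≈ey ⟩
      d * (e * y)     ≡⟨ swap e d y ⟨
      e * d * y       ≈⟨ *-congʳ y ed≈1 ⟩
      1ℤ * y          ≡⟨ ℤₚ.*-identityˡ y ⟩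
      y               ∎
    where open ≈-Reasoning
          swap : ∀ e d x → e * d * x ≡ d * (e * x)
          swap = solve-∀

  -- For n = 2s, e * s ≈ s says that e is odd; a unit modulo an even number is.
  invertible-fixes-half : ∀ {e d} s → n ≡ s ℕ.+ s → e * d ≈ 1ℤ → e * + s ≈ + s
  invertible-fixes-half {e} {d} s n≡s+s ed≈1
    with e %ℤ + 2 | n%d<d e (+ 2) | a≡a%n+[a/n]*n e (+ 2) | signed ed≈1
  ... | 0 | _ | e≡2q | divides p ed-1≡pn =
    ⊥-elim (ℕₚ.<⇒≱ (ℕₚ.n<1+n 1) (ℕ∣⇒≤ (∣⇒∣ᵤ two∣one)))
    where
      open ≡-Reasoning
      q = e /ℤ + 2
      two∣one : + 2 ∣ₛ 1ℤ
      two∣one = divides (q * d - p * + s) (begin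
          1ℤ                                    ≡⟨ cancel (e * d) ⟩
          e * d - (e * d - 1ℤ)                  ≡⟨ cong (λ z → e * d - z) ed-1≡pn ⟩
          e * d - p * + n                       ≡⟨ cong₂ (λ e m → e * d - p * + m) e≡2q n≡s+s ⟩
          (+ 0 + q * + 2) * d - p * (+ s + + s) ≡⟨ regroup q d p (+ s) ⟩
          (q * d - p * + s) * + 2               ∎)
        where cancel : ∀ x → 1ℤ ≡ x - (x - 1ℤ)
              cancel = solve-∀
              regroup : ∀ q d p s → (+ 0 + q * + 2) * d - p * (s + s) ≡ (q * d - p * s) * + 2
              regroup = solve-∀
  ... | 1 | _ | e≡1+2q | _ = ≈-by (e /ℤ + 2) (begin
      e * + s - + s                            ≡⟨ cong (λ e → e * + s - + s) e≡1+2q ⟩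
      (1ℤ + e /ℤ + 2 * + 2) * + s - + s       ≡⟨ halve (e /ℤ + 2) (+ s) ⟩
      e /ℤ + 2 * (+ s + + s)                  ≡⟨ cong (λ m → e /ℤ + 2 * + m) n≡s+s ⟨
      e /ℤ + 2 * + n                          ∎)
    where open ≡-Reasoning
          halve : ∀ q s → (1ℤ + q * + 2) * s - s ≡ q * (s + s)
          halve = solve-∀
  ... | suc (suc _) | 2+r<2 | _ | _ = ⊥-elim (ℕₚ.<⇒≱ 2+r<2 (s≤s (s≤s ℕ.z≤n)))

  coprime⇒invertible : ∀ {m} → ℕC.Coprime m n → ∃ λ e → e * + m ≈ 1ℤ
  coprime⇒invertible {m} coprime with ℕC.coprime-Bézout coprime
  ... | Bézout.+- x y 1+yn≡xm = + x , ≈-by (+ y) (begin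
      + x * + m - 1ℤ            ≡⟨ cong (_- 1ℤ) (ℤₚ.pos-* x m) ⟨
      + (x ℕ.* m) - 1ℤ          ≡⟨ cong (λ z → + z - 1ℤ) 1+yn≡xm ⟨
      1ℤ + + (y ℕ.* n) - 1ℤ     ≡⟨ cancel (+ (y ℕ.* n)) ⟩
      + (y ℕ.* n)               ≡⟨ ℤₚ.pos-* y n ⟩
      + y * + n                 ∎)
    where open ≡-Reasoning
          cancel : ∀ z → 1ℤ + z - 1ℤ ≡ z
          cancel = solve-∀
  ... | Bézout.-+ x y 1+xm≡yn = - + x , ≈-by (- + y) (begin
      - + x * + m - 1ℤ          ≡⟨ negate (+ x) (+ m) ⟩
      - (1ℤ + + x * + m)        ≡⟨ cong (λ z → - (1ℤ + z)) (ℤₚ.pos-* x m) ⟨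
      - + (1 ℕ.+ x ℕ.* m)       ≡⟨ cong (λ z → - + z) 1+xm≡yn ⟩
      - + (y ℕ.* n)             ≡⟨ cong -_ (ℤₚ.pos-* y n) ⟩
      - (+ y * + n)             ≡⟨ ℤₚ.neg-distribˡ-* (+ y) (+ n) ⟩
      - + y * + n               ∎)
    where open ≡-Reasoning
          negate : ∀ x m → - x * m - 1ℤ ≡ - (1ℤ + x * m)
          negate = solve-∀

  gcd≡1⇒invertible : ∀ d → gcd d (+ n) ≡ 1ℤ → ∃ λ e → e * d ≈ 1ℤ
  gcd≡1⇒invertible d gcd≡1 with coprime⇒invertible (ℕC.gcd≡1⇒coprime (ℤₚ.+-injective gcd≡1))
      | ℤₚ.+∣i∣≡i⊎+∣i∣≡-i d
  ... | e , e∣d∣≈1 | inj₁ ∣d∣≡d = e , subst (λ z → e * z ≈ 1ℤ) ∣d∣≡d e∣d∣≈1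
  ... | e , e∣d∣≈1 | inj₂ ∣d∣≡-d = - e , (begin
      - e * d          ≡⟨ move-neg e d ⟩
      e * - d          ≡⟨ cong (e *_) ∣d∣≡-d ⟨
      e * + ∣ d ∣      ≈⟨ e∣d∣≈1 ⟩
      1ℤ               ∎)
    where open ≈-Reasoning
          move-neg : ∀ e d → - e * d ≡ e * - d
          move-neg = solve-∀

  positive≉0 : ∀ {c} → 0 ℕ.< c → c ℕ.< n → ¬ + c ≈ 0ℤ
  positive≉0 {suc c} _ c<n (mk≈ n∣c) =
    ℕₚ.<⇒≱ c<n (ℕ∣⇒≤ (subst (n ℕ∣_) (ℕₚ.+-identityʳ (suc c)) n∣c))

  ι : Fin n → ℤ
  ι x = + toℕ x

  reduce : ℤ → Fin n
  reduce z = Fin.fromℕ< (n%ℕd<d z n)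

  ι-reduce : ∀ z → ι (reduce z) ≈ z
  ι-reduce z = ≈-by (- (z /ℕ n)) (begin
      ι (reduce z) - z
    ≡⟨ cong (λ r → + r - z) (Finₚ.toℕ-fromℕ< (n%ℕd<d z n)) ⟩
      + (z %ℕ n) - z
    ≡⟨ cong (λ w → + (z %ℕ n) - w) (a≡a%ℕn+[a/ℕn]*n z n) ⟩
      + (z %ℕ n) - (+ (z %ℕ n) + (z /ℕ n) * + n)
    ≡⟨ cancel (+ (z %ℕ n)) (z /ℕ n) (+ n) ⟩
      - (z /ℕ n) * + n ∎)
    where open ≡-Reasoning
          cancel : ∀ r q n → r - (r + q * n) ≡ - q * n
          cancel = solve-∀

  ι-injective : ∀ {x y : Fin n} → ι x ≈ ι y → x ≡ y
  ι-injective {x} {y} (mk≈ n∣gap) =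
    Finₚ.toℕ-injective (ℤₚ.+-injective
      (ℤₚ.i-j≡0⇒i≡j (ι x) (ι y) (ℤₚ.∣i∣≡0⇒i≡0 gap≡0)))
    where
      gap<n : ∣ ι x - ι y ∣ ℕ.< n
      gap<n = subst (ℕ._< n) (cong ∣_∣ (sym (ℤₚ.[+m]-[+n]≡m⊖n (toℕ x) (toℕ y))))
        (ℕₚ.≤-<-trans (ℤₚ.∣m⊝n∣≤m⊔n (toℕ x) (toℕ y))
          (ℕₚ.⊔-pres-<m (Finₚ.toℕ<n x) (Finₚ.toℕ<n y)))
      gap≡0 : ∣ ι x - ι y ∣ ≡ 0
      gap≡0 = trans (sym (m<n⇒m%n≡m gap<n)) (n∣m⇒m%n≡0 _ n n∣gap)

infixl 5 _⊕_
_⊕_ : ∀ {n} → Fin n → ℕ → Fin n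
x ⊕ i = iterate cycSucc x i

⊕-+ : ∀ {n} (x : Fin n) i j → x ⊕ (i ℕ.+ j) ≡ (x ⊕ i) ⊕ j
⊕-+ x zero j = refl
⊕-+ x (suc i) j = ⊕-+ (cycSucc x) i j

ι-cycSucc : ∀ {n} .{{_ : ℕ.NonZero n}} (x : Fin n) →
  let open Modular n in ι (cycSucc x) ≈ 1ℤ + ι x
ι-cycSucc {suc m} x = Modular.ι-reduce (suc m) (+ suc (toℕ x))

module Rotation (n : ℕ) .{{_ : ℕ.NonZero n}} where

  open import Data.Integer using (_*_)

  open Modular n

  ι-⊕ : ∀ x i → ι (x ⊕ i) ≈ + i + ι x
  ι-⊕ x zero = ≈-reflexive (sym (ℤₚ.+-identityˡ (ι x)))
  ι-⊕ x (suc i) = begin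
      ι (cycSucc x ⊕ i)      ≈⟨ ι-⊕ (cycSucc x) i ⟩
      + i + ι (cycSucc x)    ≈⟨ +-cong (≈-refl {+ i}) (ι-cycSucc x) ⟩
      + i + (1ℤ + ι x)       ≡⟨ shuffle (+ i) (ι x) ⟩
      + suc i + ι x          ∎
    where open ≈-Reasoning
          shuffle : ∀ i x → i + (1ℤ + x) ≡ (1ℤ + i) + x
          shuffle = solve-∀

  ⊕-≡ : ∀ {x y} i → ι y ≈ + i + ι x → x ⊕ i ≡ y
  ⊕-≡ {x} i y≈x+i = ι-injective (≈-trans (ι-⊕ x i) (≈-sym y≈x+i))

  ⊕-fixed : ∀ {x : Fin n} i → x ⊕ i ≡ x → + i ≈ 0ℤ
  ⊕-fixed {x} i x⊕i≡x = +-cancelʳ (ι x) (begin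
      + i + ι x       ≈⟨ ι-⊕ x i ⟨
      ι (x ⊕ i)       ≡⟨ cong ι x⊕i≡x ⟩
      ι x             ≡⟨ ℤₚ.+-identityˡ (ι x) ⟨
      0ℤ + ι x        ∎)
    where open ≈-Reasoning

  ⊕-multiple : ∀ (x : Fin n) q → x ⊕ (q ℕ.* n) ≡ x
  ⊕-multiple x q = ⊕-≡ (q ℕ.* n) (begin
      ι x                    ≡⟨ ℤₚ.+-identityˡ (ι x) ⟨
      0ℤ + ι x               ≈⟨ +-cong (≈-sym (multiple≈0 (+ q))) (≈-refl {ι x}) ⟩
      + q * + n + ι x        ≡⟨ cong (_+ ι x) (ℤₚ.pos-* q n) ⟨
      + (q ℕ.* n) + ι x      ∎)
    where open ≈-Reasoning

  cycSucc-injective : Injective _≡_ _≡_ (cycSucc {n})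
  cycSucc-injective {x} {y} ρx≡ρy = ι-injective (+-cancelʳ 1ℤ (begin
      ι x + 1ℤ           ≡⟨ ℤₚ.+-comm (ι x) 1ℤ ⟩
      1ℤ + ι x           ≈⟨ ι-cycSucc x ⟨
      ι (cycSucc x)      ≡⟨ cong ι ρx≡ρy ⟩
      ι (cycSucc y)      ≈⟨ ι-cycSucc y ⟩
      1ℤ + ι y           ≡⟨ ℤₚ.+-comm 1ℤ (ι y) ⟩
      ι y + 1ℤ           ∎))
    where open ≈-Reasoning

  ⊕-injective : ∀ i → Injective _≡_ _≡_ (λ (x : Fin n) → x ⊕ i)
  ⊕-injective zero eq = eq
  ⊕-injective (suc i) eq = cycSucc-injective (⊕-injective i eq)

  ⊕-reach : ∀ (x y : Fin n) → ∃ λ i → x ⊕ i ≡ y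
  ⊕-reach x y = toℕ gap , ⊕-≡ (toℕ gap) (begin
      ι y                    ≡⟨ sub-add (ι y) (ι x) ⟨
      (ι y - ι x) + ι x      ≈⟨ +-cong (ι-reduce (ι y - ι x)) (≈-refl {ι x}) ⟨
      ι gap + ι x            ∎)
    where open ≈-Reasoning
          gap = reduce (ι y - ι x)
          sub-add : ∀ y x → (y - x) + x ≡ y
          sub-add = solve-∀

  cyclic-induction : ∀ {ℓ} (P : Fin n → Set ℓ) → (∀ y → P y → P (cycSucc y)) →
    ∀ x → P x → ∀ y → P y
  cyclic-induction P step x Px y =
    subst P (proj₂ (⊕-reach x y)) (along (proj₁ (⊕-reach x y)) x Px)
    where along : ∀ i x → P x → P (x ⊕ i)
          along zero x Px = Px
          along (suc i) x Px = along i (cycSucc x) (step x Px)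

module Successor {n A} .{{_ : ℕ.NonZero n}} (v : Fin n → Fin n) (v-injective : Injective _≡_ _≡_ v)
  (arcs : ∀ i → Arc n A (v i) (v (cycSucc i))) where

  open Modular n
  open Rotation n

  private
    π : Permutation n n
    π = injective⇒permutation v-injective

  next : Fin n → Fin n
  next x = v (cycSucc (π ⟨$⟩ˡ x))

  next-v : ∀ i → next (v i) ≡ v (cycSucc i)
  next-v i = cong (v ∘ cycSucc) (Perm.inverseˡ π)

  next-arc : ∀ x → Arc n A x (next x)
  next-arc x = subst (λ y → Arc n A y (next x)) (Perm.inverseʳ π) (arcs (π ⟨$⟩ˡ x))

  next-injective : Injective _≡_ _≡_ next
  next-injective {x} {y} eq = begin
      x                  ≡⟨ Perm.inverseʳ π ⟨
      v (π ⟨$⟩ˡ x)       ≡⟨ cong v (cycSucc-injective (v-injective eq)) ⟩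
      v (π ⟨$⟩ˡ y)       ≡⟨ Perm.inverseʳ π ⟩
      y                  ∎
    where open ≡-Reasoning

  iterate-next-v : ∀ j i → iterate next (v i) j ≡ v (i ⊕ j)
  iterate-next-v zero i = refl
  iterate-next-v (suc j) i =
    trans (cong (λ y → iterate next y j) (next-v i)) (iterate-next-v j (cycSucc i))

  iterate-next-fixed : ∀ j x → iterate next x j ≡ x → + j ≈ 0ℤ
  iterate-next-fixed j x eq = ⊕-fixed j (v-injective (begin
      v (i ⊕ j)            ≡⟨ iterate-next-v j i ⟨
      iterate next (v i) j ≡⟨ cong (λ y → iterate next y j) v-i≡x ⟩
      iterate next x j     ≡⟨ eq ⟩
      x                    ≡⟨ v-i≡x ⟨
      v i                  ∎))
    where open ≡-Reasoning
          i = π ⟨$⟩ˡ x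
          v-i≡x : v i ≡ x
          v-i≡x = Perm.inverseʳ π

  parity-next : parity next ≡ parity (cycSucc {n})
  parity-next = xor-cancelˡ (parity v) (begin
      parity v xor parity next      ≡⟨ xor-comm (parity v) (parity next) ⟩
      parity next xor parity v      ≡⟨ parity-∘ next-injective v-injective ⟨
      parity (next ∘ v)             ≡⟨ parity-cong next-v ⟩
      parity (v ∘ cycSucc)          ≡⟨ parity-∘ v-injective cycSucc-injective ⟩
      parity v xor parity (cycSucc {n}) ∎)
    where open ≡-Reasoning

module _ {n} .{{_ : ℕ.NonZero n}} where

  open import Data.Integer using (_*_)
  open Modular n

  scale-circuit : ∀ {A B} e d → e * d ≈ 1ℤ →
    (∀ {c} → c ∈ A → ∃ λ c′ → c′ ∈ B × e * c ≈ c′) → HamCircuit n A → HamCircuit n B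
  scale-circuit {A} {B} e d ed≈1 image (v , v-injective , arcs) = w , w-injective , w-arcs
    where
      open ≈-Reasoning

      w : Fin n → Fin n
      w i = reduce (e * ι (v i))

      ι-w : ∀ i → ι (w i) ≈ e * ι (v i)
      ι-w i = ι-reduce (e * ι (v i))

      w-injective : Injective _≡_ _≡_ w
      w-injective {i} {j} eq = v-injective (ι-injective (*-cancelˡ {e} {d} ed≈1 (begin
          e * ι (v i)     ≈⟨ ι-w i ⟨
          ι (w i)         ≡⟨ cong ι eq ⟩
          ι (w j)         ≈⟨ ι-w j ⟩
          e * ι (v j)     ∎)))

      w-arcs : ∀ i → Arc n B (w i) (w (cycSucc i))
      w-arcs i with arcs i
      ... | c , c∈A , v↝v′ with image c∈A
      ... | c′ , c′∈B , ec≈c′ = c′ , c′∈B , ≈⇒≡[mod] (begin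
          ι (w (cycSucc i))         ≈⟨ ι-w (cycSucc i) ⟩
          e * ι (v (cycSucc i))     ≈⟨ *-congˡ e (mk≈ v↝v′) ⟩
          e * (ι (v i) + c)         ≡⟨ ℤₚ.*-distribˡ-+ e (ι (v i)) c ⟩
          e * ι (v i) + e * c       ≈⟨ +-cong (≈-sym (ι-w i)) ec≈c′ ⟩
          ι (w i) + c′              ∎)

-- A vertex labelled j leaves along the generator s + jump j of Cay(ℤ_n; s, s + 2, s + 3).
data Jump : Set where
  J₀ J₂ J₃ : Jump

jump : Jump → ℕ
jump J₀ = 0
jump J₂ = 2
jump J₃ = 3

_≟ʲ_ : DecidableEquality Jump
J₀ ≟ʲ J₀ = yes refl
J₀ ≟ʲ J₂ = no λ ()
J₀ ≟ʲ J₃ = no λ ()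
J₂ ≟ʲ J₀ = no λ ()
J₂ ≟ʲ J₂ = yes refl
J₂ ≟ʲ J₃ = no λ ()
J₃ ≟ʲ J₀ = no λ ()
J₃ ≟ʲ J₂ = no λ ()
J₃ ≟ʲ J₃ = yes refl

≢J₀-≢J₂⇒≡J₃ : ∀ {j} → j ≢ J₀ → j ≢ J₂ → j ≡ J₃
≢J₀-≢J₂⇒≡J₃ {J₀} j≢J₀ _ = ⊥-elim (j≢J₀ refl)
≢J₀-≢J₂⇒≡J₃ {J₂} _ j≢J₂ = ⊥-elim (j≢J₂ refl)
≢J₀-≢J₂⇒≡J₃ {J₃} _ _ = refl

≢J₂-≢J₃⇒≡J₀ : ∀ {j} → j ≢ J₂ → j ≢ J₃ → j ≡ J₀
≢J₂-≢J₃⇒≡J₀ {J₀} _ _ = refl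
≢J₂-≢J₃⇒≡J₀ {J₂} j≢J₂ _ = ⊥-elim (j≢J₂ refl)
≢J₂-≢J₃⇒≡J₀ {J₃} _ j≢J₃ = ⊥-elim (j≢J₃ refl)

jumps : List Jump
jumps = J₀ ∷ J₂ ∷ J₃ ∷ []

steps : ℕ → List ℤ
steps s = List.map (λ j → + s + + jump j) jumps

halfJump : Jump → Jump → ℕ
halfJump J₀ _ = 0
halfJump J₂ J₀ = 2
halfJump J₃ J₀ = 2
halfJump _ _ = 1

halfJump-one : ∀ {j j′} → j ≢ J₀ → j′ ≢ J₀ → halfJump j j′ ≡ 1
halfJump-one {J₀} j≢J₀ _ = ⊥-elim (j≢J₀ refl)
halfJump-one {J₂} {J₀} _ j′≢J₀ = ⊥-elim (j′≢J₀ refl)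
halfJump-one {J₂} {J₂} _ _ = refl
halfJump-one {J₂} {J₃} _ _ = refl
halfJump-one {J₃} {J₀} _ j′≢J₀ = ⊥-elim (j′≢J₀ refl)
halfJump-one {J₃} {J₂} _ _ = refl
halfJump-one {J₃} {J₃} _ _ = refl

halfJump-two : ∀ {j} → j ≢ J₀ → halfJump j J₀ ≡ 2
halfJump-two {J₀} j≢J₀ = ⊥-elim (j≢J₀ refl)
halfJump-two {J₂} _ = refl
halfJump-two {J₃} _ = refl

module Cay12k (k : ℕ) .{{_ : ℕ.NonZero k}} where

  open import Data.Integer using (_*_)

  private
    n s t : ℕ
    n = 12 ℕ.* k
    s = 6 ℕ.* k
    t = 3 ℕ.* k

    instance
      n-nonZero : ℕ.NonZero n
      n-nonZero = ℕₚ.m*n≢0 12 k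

    3<n : 3 ℕ.< n
    3<n = ℕₚ.≤-trans (ℕₚ.m≤m+n 4 8) (ℕₚ.m≤m*n 12 k)

    n≡s+s : n ≡ s ℕ.+ s
    n≡s+s = double k
      where double : ∀ k → 12 ℕ.* k ≡ 6 ℕ.* k ℕ.+ 6 ℕ.* k
            double = ℕ-solve-∀

    s≡t+t : s ≡ t ℕ.+ t
    s≡t+t = halve k
      where halve : ∀ k → 6 ℕ.* k ≡ 3 ℕ.* k ℕ.+ 3 ℕ.* k
            halve = ℕ-solve-∀

  open Modular n
  open Rotation n

  module Circuit (v : Fin n → Fin n) (v-injective : Injective _≡_ _≡_ v)
    (arcs : ∀ i → Arc n (steps s) (v i) (v (cycSucc i))) where

    open Successor v v-injective arcs

    private
      arc-jump : ∀ {x y} → Arc n (steps s) x y → ∃ λ j → ι y ≈ ι x + (+ s + + jump j)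
      arc-jump (c , c∈steps , x→y) with ∈-map⁻ (λ j → + s + + jump j) {xs = jumps} c∈steps
      ... | j , _ , refl = j , mk≈ x→y

    -- The jump used by the arc leaving x; it is only used through ι-next.
    abstract
      label : Fin n → Jump
      label x = proj₁ (arc-jump (next-arc x))

      ι-next : ∀ x → ι (next x) ≈ ι x + (+ s + + jump (label x))
      ι-next x = proj₂ (arc-jump (next-arc x))

    σ : Fin n → Fin n
    σ x = x ⊕ jump (label x)

    σ-≡ : ∀ x {j} → label x ≡ j → σ x ≡ x ⊕ jump j
    σ-≡ x = cong (λ j → x ⊕ jump j)

    next≡σ⊕s : ∀ x → next x ≡ σ x ⊕ s
    next≡σ⊕s x = sym (⊕-≡ s (begin
        ι (next x)                     ≈⟨ ι-next x ⟩
        ι x + (+ s + + jump (label x)) ≡⟨ shuffle (ι x) (+ s) (+ jump (label x)) ⟩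
        + s + (+ jump (label x) + ι x) ≈⟨ +-cong (≈-refl {+ s}) (ι-⊕ x (jump (label x))) ⟨
        + s + ι (σ x)                  ∎))
      where open ≈-Reasoning
            shuffle : ∀ x s j → x + (s + j) ≡ s + (j + x)
            shuffle = solve-∀

    σ-injective : Injective _≡_ _≡_ σ
    σ-injective {x} {y} eq = next-injective (begin
        next x       ≡⟨ next≡σ⊕s x ⟩
        σ x ⊕ s      ≡⟨ cong (_⊕ s) eq ⟩
        σ y ⊕ s      ≡⟨ next≡σ⊕s y ⟨
        next y       ∎)
      where open ≡-Reasoning

    -- If x jumps d further than x ⊕ d, both land on the same vertex.
    no-collision : ∀ x {j j′} d → 0 ℕ.< d → d ℕ.≤ 3 → jump j ≡ d ℕ.+ jump j′ →
      label x ≡ j → label (x ⊕ d) ≢ j′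
    no-collision x {j} {j′} d 0<d d≤3 j≡d+j′ x↦j x⊕d↦j′ =
      positive≉0 0<d (ℕₚ.≤-<-trans d≤3 3<n)
        (⊕-fixed d (σ-injective (begin
          σ (x ⊕ d)           ≡⟨ σ-≡ (x ⊕ d) x⊕d↦j′ ⟩
          x ⊕ d ⊕ jump j′     ≡⟨ ⊕-+ x d (jump j′) ⟨
          x ⊕ (d ℕ.+ jump j′) ≡⟨ cong (x ⊕_) j≡d+j′ ⟨
          x ⊕ jump j          ≡⟨ σ-≡ x x↦j ⟨
          σ x                 ∎)))
      where open ≡-Reasoning

    collide-J₂-J₀ : ∀ x → label x ≡ J₂ → label (x ⊕ 2) ≢ J₀
    collide-J₂-J₀ x = no-collision x 2 (s≤s ℕ.z≤n) (s≤s (s≤s ℕ.z≤n)) refl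

    collide-J₃-J₀ : ∀ x → label x ≡ J₃ → label (x ⊕ 3) ≢ J₀
    collide-J₃-J₀ x = no-collision x 3 (s≤s ℕ.z≤n) ℕₚ.≤-refl refl

    collide-J₃-J₂ : ∀ x → label x ≡ J₃ → label (x ⊕ 1) ≢ J₂
    collide-J₃-J₂ x = no-collision x 1 (s≤s ℕ.z≤n) (s≤s ℕ.z≤n) refl

    next-fixed : ∀ y → label y ≡ J₀ → next y ≡ y ⊕ s
    next-fixed y y↦J₀ = trans (next≡σ⊕s y) (cong (_⊕ s) (σ-≡ y y↦J₀))

    ⊕s⊕s : ∀ y → y ⊕ s ⊕ s ≡ y
    ⊕s⊕s y = begin
        y ⊕ s ⊕ s        ≡⟨ ⊕-+ y s s ⟨
        y ⊕ (s ℕ.+ s)    ≡⟨ cong (y ⊕_) (trans (sym n≡s+s) (sym (ℕₚ.*-identityˡ n))) ⟩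
        y ⊕ 1 ℕ.* n      ≡⟨ ⊕-multiple y 1 ⟩
        y                ∎
      where open ≡-Reasoning

    -- Two fixed vertices at distance s would form a 2-cycle of next.
    fixed-opposite : ∀ y → label y ≡ J₀ → label (y ⊕ s) ≢ J₀
    fixed-opposite y y↦J₀ y⊕s↦J₀ = positive≉0 (s≤s ℕ.z≤n) (ℕₚ.<-trans (ℕₚ.n<1+n 2) 3<n)
      (iterate-next-fixed 2 y (begin
        next (next y)     ≡⟨ cong next (next-fixed y y↦J₀) ⟩
        next (y ⊕ s)      ≡⟨ next-fixed (y ⊕ s) y⊕s↦J₀ ⟩
        y ⊕ s ⊕ s         ≡⟨ ⊕s⊕s y ⟩
        y                 ∎))
      where open ≡-Reasoning

    isolated-moves-impossible : (∀ y → label y ≢ J₀ → label (y ⊕ 1) ≡ J₀) → ⊥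
    isolated-moves-impossible isolated = fixed-opposite y₀ y₀↦J₀
      (subst (λ i → label (y₀ ⊕ i) ≡ J₀) (sym s≡t+t) (fixed-ahead t y₀ y₀↦J₀))
      where
        fixed-then-moving : ∀ y → label y ≡ J₀ → label (y ⊕ 1) ≢ J₀
        fixed-then-moving y y↦J₀ y⊕1↦J₀ =
          fixed-opposite (y ⊕ s ⊕ 1) (isolated (y ⊕ s) (fixed-opposite y y↦J₀))
            (subst (λ z → label z ≡ J₀) (sym back) y⊕1↦J₀)
          where back : y ⊕ s ⊕ 1 ⊕ s ≡ y ⊕ 1
                back = begin
                  y ⊕ s ⊕ 1 ⊕ s       ≡⟨ ⊕-+ (y ⊕ s) 1 s ⟨
                  y ⊕ s ⊕ suc s       ≡⟨ cong (y ⊕ s ⊕_) (ℕₚ.+-comm 1 s) ⟩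
                  y ⊕ s ⊕ (s ℕ.+ 1)   ≡⟨ ⊕-+ (y ⊕ s) s 1 ⟩
                  y ⊕ s ⊕ s ⊕ 1       ≡⟨ cong (_⊕ 1) (⊕s⊕s y) ⟩
                  y ⊕ 1               ∎
                  where open ≡-Reasoning

        fixed-ahead : ∀ i y → label y ≡ J₀ → label (y ⊕ (i ℕ.+ i)) ≡ J₀
        fixed-ahead zero y y↦J₀ = y↦J₀
        fixed-ahead (suc i) y y↦J₀ = subst (λ m → label (y ⊕ suc m) ≡ J₀) (sym (ℕₚ.+-suc i i))
          (fixed-ahead i (y ⊕ 2) (isolated (y ⊕ 1) (fixed-then-moving y y↦J₀)))

        some-vertex : Fin n
        some-vertex = reduce 0ℤ

        y₀ : Fin n
        y₀ with label some-vertex ≟ʲ J₀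
        ... | yes _ = some-vertex
        ... | no _ = some-vertex ⊕ 1

        y₀↦J₀ : label y₀ ≡ J₀
        y₀↦J₀ with label some-vertex ≟ʲ J₀
        ... | yes x↦J₀ = x↦J₀
        ... | no x↛J₀ = isolated some-vertex x↛J₀

    J₃-run : Fin n → Set
    J₃-run y = label y ≡ J₃ × label (y ⊕ 1) ≡ J₃ × label (y ⊕ 2) ≡ J₃

    all-J₃-impossible : ∀ y₀ → J₃-run y₀ → ⊥
    all-J₃-impossible y₀ run₀ =
      positive≉0 (ℕ.>-nonZero⁻¹ (4 ℕ.* k) ⦃ ℕₚ.m*n≢0 4 k ⦄)
        (ℕₚ.*-monoˡ-< k (ℕₚ.m≤m+n 5 7))
        (iterate-next-fixed (4 ℕ.* k) y₀ (begin
          iterate next y₀ (4 ℕ.* k)            ≡⟨ iterate-next (4 ℕ.* k) y₀ ⟩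
          y₀ ⊕ 4 ℕ.* k ℕ.* (3 ℕ.+ s)           ≡⟨ cong (y₀ ⊕_) (period k) ⟩
          y₀ ⊕ (1 ℕ.+ 2 ℕ.* k) ℕ.* n           ≡⟨ ⊕-multiple y₀ (1 ℕ.+ 2 ℕ.* k) ⟩
          y₀                                   ∎))
      where
        open ≡-Reasoning

        period : ∀ k → 4 ℕ.* k ℕ.* (3 ℕ.+ 6 ℕ.* k) ≡ (1 ℕ.+ 2 ℕ.* k) ℕ.* (12 ℕ.* k)
        period = ℕ-solve-∀

        all-J₃ : ∀ y → label y ≡ J₃
        all-J₃ = proj₁ ∘ cyclic-induction J₃-run
          (λ y (ℓ₀ , ℓ₁ , ℓ₂) →
            ℓ₁ , ℓ₂ , ≢J₀-≢J₂⇒≡J₃ (collide-J₃-J₀ y ℓ₀) (collide-J₃-J₂ (y ⊕ 2) ℓ₂))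
          y₀ run₀

        iterate-next : ∀ j y → iterate next y j ≡ y ⊕ j ℕ.* (3 ℕ.+ s)
        iterate-next zero y = refl
        iterate-next (suc j) y = begin
          iterate next (next y) j                ≡⟨ cong (λ z → iterate next z j) (next≡σ⊕s y) ⟩
          iterate next (σ y ⊕ s) j               ≡⟨ cong (λ z → iterate next (z ⊕ s) j)
                                                        (σ-≡ y (all-J₃ y)) ⟩
          iterate next (y ⊕ 3 ⊕ s) j             ≡⟨ iterate-next j (y ⊕ 3 ⊕ s) ⟩
          y ⊕ 3 ⊕ s ⊕ j ℕ.* (3 ℕ.+ s)            ≡⟨ cong (_⊕ j ℕ.* (3 ℕ.+ s)) (⊕-+ y 3 s) ⟨
          y ⊕ (3 ℕ.+ s) ⊕ j ℕ.* (3 ℕ.+ s)        ≡⟨ ⊕-+ y (3 ℕ.+ s) (j ℕ.* (3 ℕ.+ s)) ⟨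
          y ⊕ suc j ℕ.* (3 ℕ.+ s)                ∎

    module _ (no-J₃-run : ∀ y → ¬ J₃-run y) (y₀ : Fin n)
             (y₀⊕2↛J₀ : label (y₀ ⊕ 2) ≢ J₀) (y₀⊕3↛J₀ : label (y₀ ⊕ 3) ≢ J₀) where

      Preceded : Fin n → Set
      Preceded y = label (y ⊕ 2) ≡ J₀ → label y ≡ J₃ × label (y ⊕ 1) ≡ J₃

      preceded-step : ∀ y → Preceded y → Preceded (y ⊕ 1) → Preceded (y ⊕ 2)
      preceded-step y p₀ p₁ ℓ₄ = ℓ₂ , ℓ₃
        where
          ℓ₂ : label (y ⊕ 2) ≡ J₃
          ℓ₂ = ≢J₀-≢J₂⇒≡J₃ (λ ℓ₂ → collide-J₃-J₀ (y ⊕ 1) (proj₂ (p₀ ℓ₂)) ℓ₄)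
                           (λ ℓ₂ → collide-J₂-J₀ (y ⊕ 2) ℓ₂ ℓ₄)
          ℓ₃ : label (y ⊕ 3) ≡ J₃
          ℓ₃ = ≢J₀-≢J₂⇒≡J₃ (λ ℓ₃ → collide-J₃-J₀ (y ⊕ 1) (proj₁ (p₁ ℓ₃)) ℓ₄)
                           (collide-J₃-J₂ (y ⊕ 2) ℓ₂)

      all-preceded : ∀ y → Preceded y
      all-preceded = proj₁ ∘ cyclic-induction (λ y → Preceded y × Preceded (y ⊕ 1))
        (λ y (p₀ , p₁) → p₁ , preceded-step y p₀ p₁)
        y₀ ((λ ℓ₂ → ⊥-elim (y₀⊕2↛J₀ ℓ₂)) , (λ ℓ₃ → ⊥-elim (y₀⊕3↛J₀ ℓ₃)))

      J₂-then-moving : ∀ y → label y ≡ J₂ → label (y ⊕ 1) ≢ J₀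
      J₂-then-moving y y↦J₂ y⊕1↦J₀ = case trans (sym y↦J₂) y↦J₃ of λ ()
        where
          z : Fin n
          z = proj₁ (injective⇒strictlySurjective cycSucc-injective y)
          ρz≡y : cycSucc z ≡ y
          ρz≡y = proj₂ (injective⇒strictlySurjective cycSucc-injective y)
          y↦J₃ : label y ≡ J₃
          y↦J₃ = subst (λ w → label w ≡ J₃) ρz≡y
            (proj₂ (all-preceded z (subst (λ w → label (w ⊕ 1) ≡ J₀) (sym ρz≡y) y⊕1↦J₀)))

      J₃-then-moving-then-fixed : ∀ y → label y ≡ J₃ → label (y ⊕ 1) ≢ J₀ → label (y ⊕ 2) ≡ J₀
      J₃-then-moving-then-fixed y ℓ₀ ℓ₁≢J₀ =
        ≢J₂-≢J₃⇒≡J₀ (collide-J₃-J₂ (y ⊕ 1) ℓ₁) (λ ℓ₂ → no-J₃-run y (ℓ₀ , ℓ₁ , ℓ₂))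
        where ℓ₁ = ≢J₀-≢J₂⇒≡J₃ ℓ₁≢J₀ (collide-J₃-J₂ y ℓ₀)

      -- A square root of σ: a moving vertex advances by 2 onto a fixed vertex, and by 1 otherwise.
      h : Fin n → Fin n
      h y = y ⊕ halfJump (label y) (label (y ⊕ 1))

      h-fixed : ∀ y → label y ≡ J₀ → h y ≡ y
      h-fixed y y↦J₀ = cong (λ j → y ⊕ halfJump j (label (y ⊕ 1))) y↦J₀

      h-one : ∀ y → label y ≢ J₀ → label (y ⊕ 1) ≢ J₀ → h y ≡ y ⊕ 1
      h-one y ℓ₀ ℓ₁ = cong (y ⊕_) (halfJump-one ℓ₀ ℓ₁)

      h-two : ∀ y → label y ≢ J₀ → label (y ⊕ 1) ≡ J₀ → h y ≡ y ⊕ 2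
      h-two y ℓ₀ ℓ₁ = cong (y ⊕_) (trans (cong (halfJump (label y)) ℓ₁) (halfJump-two ℓ₀))

      h∘h≗σ : ∀ y → h (h y) ≡ σ y
      h∘h≗σ y = by-label (label y) refl
        where
          moving : ∀ {j} → label y ≡ j → j ≢ J₀ → label y ≢ J₀
          moving ℓ₀ j≢J₀ = j≢J₀ ∘ trans (sym ℓ₀)

          by-label : ∀ j → label y ≡ j → h (h y) ≡ σ y
          by-label J₀ ℓ₀ = trans (cong h (h-fixed y ℓ₀)) (trans (h-fixed y ℓ₀) (sym (σ-≡ y ℓ₀)))
          by-label J₂ ℓ₀ = trans (cong h (h-one y (moving ℓ₀ λ ()) ℓ₁))
                             (trans (h-one (y ⊕ 1) ℓ₁ (collide-J₂-J₀ y ℓ₀)) (sym (σ-≡ y ℓ₀)))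
            where ℓ₁ = J₂-then-moving y ℓ₀
          by-label J₃ ℓ₀ with label (y ⊕ 1) ≟ʲ J₀
          ... | yes ℓ₁ = trans (cong h (h-two y (moving ℓ₀ λ ()) ℓ₁))
                           (trans (h-one (y ⊕ 2) ℓ₂ (collide-J₃-J₀ y ℓ₀)) (sym (σ-≡ y ℓ₀)))
            where ℓ₂ : label (y ⊕ 2) ≢ J₀
                  ℓ₂ y⊕2↦J₀ = case trans (sym ℓ₁) (proj₂ (all-preceded y y⊕2↦J₀)) of λ ()
          ... | no ℓ₁ = trans (cong h (h-one y (moving ℓ₀ λ ()) ℓ₁))
                          (trans (h-two (y ⊕ 1) ℓ₁ (J₃-then-moving-then-fixed y ℓ₀ ℓ₁))
                                 (sym (σ-≡ y ℓ₀)))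

      h-injective : Injective _≡_ _≡_ h
      h-injective {x} {y} eq = σ-injective (trans (sym (h∘h≗σ x)) (trans (cong h eq) (h∘h≗σ y)))

      -- next = (⊕ t)² ∘ h² is even, while next is conjugate to the rotation, an n-cycle with n even.
      parity-impossible : ⊥
      parity-impossible = case trans (sym (cycSucc-odd s n≡s+s)) (begin
          parity (cycSucc {n})          ≡⟨ parity-next ⟨
          parity next                   ≡⟨ parity-cong next≡τ∘h∘h ⟩
          parity (τ ∘ (h ∘ h))          ≡⟨ parity-∘ τ-injective h∘h-injective ⟩
          parity τ xor parity (h ∘ h)   ≡⟨ cong₂ _xor_ (parity-square (⊕-injective t))
                                                      (parity-square h-injective) ⟩
          false                         ∎) of λ ()
        where
          open ≡-Reasoning
          τ : Fin n → Fin n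
          τ y = y ⊕ t ⊕ t
          τ-injective : Injective _≡_ _≡_ τ
          τ-injective = ⊕-injective t ∘ ⊕-injective t
          h∘h-injective : Injective _≡_ _≡_ (h ∘ h)
          h∘h-injective = h-injective ∘ h-injective
          next≡τ∘h∘h : ∀ y → next y ≡ τ (h (h y))
          next≡τ∘h∘h y = begin
            next y                ≡⟨ next≡σ⊕s y ⟩
            σ y ⊕ s               ≡⟨ cong₂ _⊕_ (sym (h∘h≗σ y)) s≡t+t ⟩
            h (h y) ⊕ (t ℕ.+ t)   ≡⟨ ⊕-+ (h (h y)) t t ⟩
            τ (h (h y))           ∎

    impossible : ⊥
    impossible = by-runs
      (Finₚ.any? λ y → (label y ≟ʲ J₃) ×-dec (label (y ⊕ 1) ≟ʲ J₃) ×-dec (label (y ⊕ 2) ≟ʲ J₃))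
      where
        Adjacent-moves : Fin n → Set
        Adjacent-moves y = label (y ⊕ 2) ≢ J₀ × label (y ⊕ 3) ≢ J₀

        isolated : ¬ ∃ Adjacent-moves → ∀ z → label z ≢ J₀ → label (z ⊕ 1) ≡ J₀
        isolated none z z↛J₀ with label (z ⊕ 1) ≟ʲ J₀
        ... | yes z⊕1↦J₀ = z⊕1↦J₀
        ... | no z⊕1↛J₀ = ⊥-elim (none (y , subst (λ w → label w ≢ J₀) (sym y⊕2≡z) z↛J₀
                                          , subst (λ w → label (w ⊕ 1) ≢ J₀) (sym y⊕2≡z) z⊕1↛J₀))
          where
            y : Fin n
            y = proj₁ (injective⇒strictlySurjective (⊕-injective 2) z)
            y⊕2≡z : y ⊕ 2 ≡ z
            y⊕2≡z = proj₂ (injective⇒strictlySurjective (⊕-injective 2) z)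

        by-runs : Dec (∃ J₃-run) → ⊥
        by-runs (yes (y , run)) = all-J₃-impossible y run
        by-runs (no no-J₃-run)
          with Finₚ.any? (λ y → ¬? (label (y ⊕ 2) ≟ʲ J₀) ×-dec ¬? (label (y ⊕ 3) ≟ʲ J₀))
        ... | yes (y₀ , ℓ₂ , ℓ₃) = parity-impossible (λ y run → no-J₃-run (y , run)) y₀ ℓ₂ ℓ₃
        ... | no none = isolated-moves-impossible (isolated none)

  no-circuit : ¬ HamCircuit (12 ℕ.* k) (steps (6 ℕ.* k))
  no-circuit (v , v-injective , arcs) = Circuit.impossible v v-injective arcs

  private
    rescaled-circuit : ∀ {a b} d ja jb → gcd d (+ n) ≡ 1ℤ →
      a ≈ + s + + jump ja * d → b ≈ + s + + jump jb * d →
      HamCircuit n (+ s ∷ a ∷ b ∷ []) → HamCircuit n (steps s)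
    rescaled-circuit {a} {b} d ja jb gcd≡1 a≈ b≈ = scale-circuit e d ed≈1 image
      where
        e : ℤ
        e = proj₁ (gcd≡1⇒invertible d gcd≡1)
        ed≈1 : e * d ≈ 1ℤ
        ed≈1 = proj₂ (gcd≡1⇒invertible d gcd≡1)

        es≈s : e * + s ≈ + s
        es≈s = invertible-fixes-half {e} {d} s n≡s+s ed≈1

        scaled : ∀ {c} j → c ≈ + s + + jump j * d → e * c ≈ + s + + jump j
        scaled {c} j c≈ = begin
            e * c                           ≈⟨ *-congˡ e c≈ ⟩
            e * (+ s + + jump j * d)        ≡⟨ distribute e (+ s) (+ jump j) d ⟩
            e * + s + + jump j * (e * d)    ≈⟨ +-cong es≈s (*-congˡ (+ jump j) ed≈1) ⟩
            + s + + jump j * 1ℤ             ≡⟨ cong (λ z → + s + z) (ℤₚ.*-identityʳ (+ jump j)) ⟩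
            + s + + jump j                  ∎
          where open ≈-Reasoning
                distribute : ∀ e s j d → e * (s + j * d) ≡ e * s + j * (e * d)
                distribute = solve-∀

        jump∈steps : ∀ j → + s + + jump j ∈ steps s
        jump∈steps J₀ = here refl
        jump∈steps J₂ = there (here refl)
        jump∈steps J₃ = there (there (here refl))

        image : ∀ {c} → c ∈ (+ s ∷ a ∷ b ∷ []) → ∃ λ c′ → c′ ∈ steps s × e * c ≈ c′
        image (here refl) = _ , jump∈steps J₀ , scaled J₀ (≈-reflexive (no-jump (+ s) d))
          where no-jump : ∀ s d → s ≡ s + + 0 * d
                no-jump = solve-∀
        image (there (here refl)) = _ , jump∈steps ja , scaled ja a≈
        image (there (there (here refl))) = _ , jump∈steps jb , scaled jb b≈

    ≈-linear′ : ∀ {x y u w} c q → x ≈ y → u - w ≡ c * (x - y) + q * (+ s + + s) → u ≈ w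
    ≈-linear′ {x} {y} c q x≈y eq = ≈-linear c q x≈y
      (trans eq (cong (λ m → c * (x - y) + q * + m) (sym n≡s+s)))

  no-circuit-2a-3b : ∀ a b → gcd (a - b) (+ n) ≡ 1ℤ → + 2 * a - + 3 * b ≈ + s →
    ¬ HamCircuit n (+ s ∷ a ∷ b ∷ [])
  no-circuit-2a-3b a b gcd≡1 2a-3b≈s = no-circuit ∘ rescaled-circuit (a - b) J₃ J₂ gcd≡1
    (≈-linear′ (- 1ℤ) (- 1ℤ) 2a-3b≈s (rearrange-a a b (+ s)))
    (≈-linear′ (- 1ℤ) (- 1ℤ) 2a-3b≈s (rearrange-b a b (+ s)))
    where
      rearrange-a : ∀ a b s → a - (s + + 3 * (a - b)) ≡ - 1ℤ * (+ 2 * a - + 3 * b - s) + - 1ℤ * (s + s)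
      rearrange-a = solve-∀
      rearrange-b : ∀ a b s → b - (s + + 2 * (a - b)) ≡ - 1ℤ * (+ 2 * a - + 3 * b - s) + - 1ℤ * (s + s)
      rearrange-b = solve-∀

  no-circuit-3a-2b : ∀ a b → gcd (a - b) (+ n) ≡ 1ℤ → + 3 * a - + 2 * b ≈ + s →
    ¬ HamCircuit n (+ s ∷ a ∷ b ∷ [])
  no-circuit-3a-2b a b gcd≡1 3a-2b≈s = no-circuit ∘ rescaled-circuit (b - a) J₂ J₃
    (trans (cong (λ m → + ℕGCD.gcd m n) (ℤₚ.∣i-j∣≡∣j-i∣ b a)) gcd≡1)
    (≈-linear′ 1ℤ 0ℤ 3a-2b≈s (rearrange-a a b (+ s)))
    (≈-linear′ 1ℤ 0ℤ 3a-2b≈s (rearrange-b a b (+ s)))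
    where
      rearrange-a : ∀ a b s → a - (s + + 2 * (b - a)) ≡ 1ℤ * (+ 3 * a - + 2 * b - s) + 0ℤ * (s + s)
      rearrange-a = solve-∀
      rearrange-b : ∀ a b s → b - (s + + 3 * (b - a)) ≡ 1ℤ * (+ 3 * a - + 2 * b - s) + 0ℤ * (s + s)
      rearrange-b = solve-∀

open import Data.Nat using (_≤_; _*_)

corollary1p4 : (k : ℕ) → 1 ≤ k → (a b : ℤ) →
    gcd (a - b) (+ (12 * k)) ≡ + 1 →
    ((+ 2 ℤ.* a - + 3 ℤ.* b) ≡ + (6 * k) [mod 12 * k ]
      ⊎ (+ 3 ℤ.* a - + 2 ℤ.* b) ≡ + (6 * k) [mod 12 * k ]) →
    ¬ HamCircuit (12 * k) (+ (6 * k) ∷ a ∷ b ∷ [])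
corollary1p4 k@(suc _) _ a b gcd≡1 (inj₁ 2a-3b≡6k) =
  Cay12k.no-circuit-2a-3b k a b gcd≡1 (Modular.mk≈ 2a-3b≡6k)
corollary1p4 k@(suc _) _ a b gcd≡1 (inj₂ 3a-2b≡6k) =
  Cay12k.no-circuit-3a-2b k a b gcd≡1 (Modular.mk≈ 3a-2b≡6k)
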